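{- Let $\mathcal{T}$ be a BSTSO instance in which every tree has $2$, $3$ or $4$ elements, and let $\mathcal{T}^{\mathrm{depth}\le2}:=\mathcal{T}_2\cup\mathcal{T}_3'\cup\mathcal{T}_4^{\mathrm{depth}2}$ be as defined below. There exists an optimum solution for the instance $\mathcal{T}^{\mathrm{depth}\le2}$ whose circuit has depth $2$ in the following sense: every vertex $v$ with $|S(v)|=4$ has as its two predecessors vertices $u,w$ with $|S(u)|=|S(w)|=2$.
   Context: BSTSO: Fix an associative, commutative binary operator $\circ$ on $\{0,1\}$. An instance is a finite family of subsets of $\{1,\dots,n\}$ (trees). A circuit is a directed acyclic graph with inputs (in-degree $0$, each associated with a variable $x_i$) and gates (in-degree $2$); each vertex $v$ has a variable set $S(v)$, with $S(v)=\{i\}$ for the input of $x_i$ and, for a gate with predecessors $u,w$, $S(u)\cap S(w)=\emptyset$ and $S(v)=S(u)\cup S(w)$. A solution for a family is a circuit in which every member equals $S(v)$ for some vertex $v$; an optimum solution is one with the minimum number of gates. Sets: $\mathcal{T}_i:=\{T\in\mathcal{T}:|T|=i\}$; $\mathcal{T}^{\supsetneq 3}:=\{T\in\mathcal{T}_4:\exists T'\in\mathcal{T}_3,\ T'\subsetneq T\}$; $\mathcal{T}^{\mathrm{intersect}}$: start with $B:=\mathcal{T}^{\supsetneq 3}$ and, while there exist $\ell\ge3$ distinct $T_1,\dots,T_\ell\in\mathcal{T}_4\setminus B$ with $|T_1\cap\dots\cap T_\ell|=3$, add such trees to $B$; $\mathcal{T}^{\mathrm{intersect}}$ is the set of trees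 added in this loop. Let $G$ be the graph with vertex set $\mathcal{T}_4\setminus(\mathcal{T}^{\supsetneq 3}\cup\mathcal{T}^{\mathrm{intersect}})$ and edges $\{T,T'\}$ with $|T\cap T'|=3$; let $M^{\max}$ be a maximum matching in $G$ and $\mathcal{T}_4^{\mathrm{matching}}$ the trees it covers. $\mathcal{T}_4^{\mathrm{depth}2}:=\mathcal{T}_4\setminus(\mathcal{T}^{\supsetneq 3}\cup\mathcal{T}^{\mathrm{intersect}}\cup\mathcal{T}_4^{\mathrm{matching}})$; $\mathcal{T}_3':=\mathcal{T}_3\cup\{T\cap T':\{T,T'\}\in M^{\max}\}$. -}

module Defs where

open import Data.Nat using (ℕ; zero; suc; _+_; _≤_; _≥_)
open import Data.Fin using (Fin; zero; suc)
open import Data.Fin.Subset using (Subset; _∩_; _∪_; ⁅_⁆; ∣_∣; _⊂_; Empty; ⊤)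
open import Data.List using (List; []; _∷_; length; foldr; concatMap)
open import Data.List.Membership.Propositional renaming (_∈_ to _∈ᴸ_)
open import Data.List.Relation.Unary.Unique.Propositional using (Unique)
open import Data.List.Relation.Unary.All using (All)
open import Data.Product using (Σ; ∃; ∃-syntax; _×_; _,_)
open import Data.Sum using (_⊎_)
open import Data.Empty using (⊥)
open import Relation.Nullary using (¬_)
open import Relation.Binary.PropositionalEquality using (_≡_)

-- Circuits (straight-line programs over the variables x_1..x_n,
-- represented by Fin n).  A circuit with k gates has k + n vertices:
-- the n inputs (one per variable) and k gates.  Gates are added one at
-- a time; the newest gate is vertex 'zero', older vertices are shifted
-- by 'suc'.  Each gate names its two predecessors among the earlier
-- vertices, so the graph is acyclic by construction.

data Gates (n : ℕ) : ℕ → Set where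
  []  : Gates n 0
  _▷_ : ∀ {k} → Gates n k → Fin (k + n) × Fin (k + n) → Gates n (suc k)

S : ∀ {n k} → Gates n k → Fin (k + n) → Subset n
S []              i       = ⁅ i ⁆
S (g ▷ (a , b))   zero    = S g a ∪ S g b
S (g ▷ _)         (suc i) = S g i

Valid : ∀ {n k} → Gates n k → Set
Valid []            = Data.Unit.⊤ where import Data.Unit
Valid (g ▷ (a , b)) = Valid g × Empty (S g a ∩ S g b)

record Circuit (n : ℕ) : Set where
  constructor circuit
  field
    size  : ℕ
    gates : Gates n size
    valid : Valid gates

open Circuit public

Fam : ℕ → Set₁
Fam n = Subset n → Set

IsSolution : ∀ {n} → Fam n → Circuit n → Set
IsSolution F C = ∀ T → F T → ∃[ v ] S (gates C) v ≡ T

IsOptimum : ∀ {n} → Fam n → Circuit n → Set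
IsOptimum F C = IsSolution F C × (∀ C′ → IsSolution F C′ → size C ≤ size C′)

-- depth-2 property: every vertex with |S(v)| = 4 is a gate whose two
-- predecessors u, w satisfy |S(u)| = |S(w)| = 2  (inputs have |S| = 1)
Depth2Gates : ∀ {n k} → Gates n k → Set
Depth2Gates []            = Data.Unit.⊤ where import Data.Unit
Depth2Gates (g ▷ (a , b)) =
  Depth2Gates g × (∣ S g a ∪ S g b ∣ ≡ 4 → ∣ S g a ∣ ≡ 2 × ∣ S g b ∣ ≡ 2)

Depth2 : ∀ {n} → Circuit n → Set
Depth2 C = Depth2Gates (gates C)

module _ {n : ℕ} (𝒯 : List (Subset n)) where

  𝒯ₛ : ℕ → Fam n
  𝒯ₛ i X = X ∈ᴸ 𝒯 × ∣ X ∣ ≡ i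

  𝒯⊋3 : Fam n
  𝒯⊋3 X = 𝒯ₛ 4 X × ∃[ Y ] (𝒯ₛ 3 Y × Y ⊂ X)

  ⋂ : List (Subset n) → Subset n
  ⋂ = foldr _∩_ ⊤

  -- one admissible step of the loop w.r.t. the current set B:
  -- ℓ ≥ 3 distinct trees of 𝒯_4 \ B with |T_1 ∩ … ∩ T_ℓ| = 3
  IntersectStep : Fam n → List (Subset n) → Set
  IntersectStep B L =
    length L ≥ 3 × Unique L × All (λ X → 𝒯ₛ 4 X × ¬ B X) L × ∣ ⋂ L ∣ ≡ 3

  -- IntersectRun B R : a complete run of the while loop starting from
  -- B, in which R is the set of trees added by the loop
  data IntersectRun (B : Fam n) : Fam n → Set₁ where
    done : (∀ L → ¬ IntersectStep B L) → IntersectRun B (λ _ → ⊥)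
    step : ∀ {R} (L : List (Subset n)) → IntersectStep B L →
           IntersectRun (λ X → B X ⊎ X ∈ᴸ L) R →
           IntersectRun B (λ X → X ∈ᴸ L ⊎ R X)

  module _ (𝒯int : Fam n) where

    GVertex : Fam n
    GVertex X = 𝒯ₛ 4 X × ¬ 𝒯⊋3 X × ¬ 𝒯int X

    GEdge : Subset n → Subset n → Set
    GEdge X Y = GVertex X × GVertex Y × ∣ X ∩ Y ∣ ≡ 3

    endpoints : List (Subset n × Subset n) → List (Subset n)
    endpoints = concatMap (λ { (X , Y) → X ∷ Y ∷ [] })

    IsMatching : List (Subset n × Subset n) → Set
    IsMatching M = All (λ { (X , Y) → GEdge X Y }) M × Unique (endpoints M)

    IsMaxMatching : List (Subset n × Subset n) → Set
    IsMaxMatching M =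
      IsMatching M × (∀ M′ → IsMatching M′ → length M′ ≤ length M)

    module _ (M : List (Subset n × Subset n)) where

      𝒯₄matching : Fam n
      𝒯₄matching X = X ∈ᴸ endpoints M

      𝒯₄depth2 : Fam n
      𝒯₄depth2 X = 𝒯ₛ 4 X × ¬ 𝒯⊋3 X × ¬ 𝒯int X × ¬ 𝒯₄matching X

      𝒯₃′ : Fam n
      𝒯₃′ X = 𝒯ₛ 3 X ⊎ ∃[ Y ] ∃[ Z ] ((Y , Z) ∈ᴸ M × X ≡ Y ∩ Z)

      𝒯depth≤2 : Fam n
      𝒯depth≤2 X = 𝒯ₛ 2 X ⊎ 𝒯₃′ X ⊎ 𝒯₄depth2 X

{-# OPTIONS --safe #-}
module Submission where

-- A canonical circuit is determined by a set L of pairs: its gates are the pairs of L, one gate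
-- per member of 𝒯₃′ (a pair of L plus an input) and one per member of 𝒯₄^{depth2} (two pairs of L),
-- so it has depth 2 and |𝒯₃′| + |𝒯₄^{depth2}| + |L| gates. Conversely, in any solution C every tree
-- T of 𝒯₄^{depth2} is a gate splitting into two pairs, or into a triple gate X and an input; in the
-- latter case X contains a pair gate A, and T ─ A is charged to X. These X are not in 𝒯₃′ (T is
-- neither in 𝒯^{⊋3} nor can it continue the intersection loop) and are distinct for distinct T
-- (two trees sharing X would augment the maximum matching), so the pair gates of C together with
-- the charged pairs form an L whose canonical circuit is no larger than C. Minimising over the
-- finitely many sets of pairs gives an optimum circuit of depth 2.

open import Defs
open import Data.Nat using (ℕ)
open import Data.Fin.Subset using (Subset; ∣_∣)
open import Data.List using (List)
open import Data.List.Relation.Unary.All using (All)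
open import Data.Product using (Σ; ∃-syntax; _×_)
open import Data.Sum using (_⊎_)
open import Relation.Binary.PropositionalEquality using (_≡_)

open import Data.Bool using (true; false)
import Data.Bool.Properties as Bool
open import Data.Empty using (⊥-elim)
open import Data.Fin using (Fin; zero; suc)
open import Data.Fin.Subset using (_⊆_; _⊂_; _∩_; _∪_; _─_; ⁅_⁆; ⊥; ⊤; Empty; outside)
open import Data.Fin.Subset.Properties
  using ( drop-∷-Empty; drop-∷-⊆; ⊥⊆; ∣⊥∣≡0; ∣⁅x⁆∣≡1; in⊆in; out⊆; s⊂s; out⊂in
        ; p⊆p∪q; q⊆p∪q; p∩q⊆p; p∩q⊆q; x∈p∩q⁺; ⊆-antisym; ⊆-trans; _⊆?_; _⊂?_; nonempty?
        ; p⊆q⇒∣p∣≤∣q∣; p⊂q⇒∣p∣<∣q∣; ∣p∣≤∣p∪q∣; ∣p∩q∣≤∣p∣; ∩-identityʳ )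
open import Data.List using ([]; _∷_; length; _++_; map; filter; deduplicate)
open import Data.List.Extrema.Nat using (argmin; argmin-all; f[argmin]≤f[xs])
open import Data.List.Membership.Propositional using (_∈_; find; lose)
open import Data.List.Membership.Propositional.Properties
  using (∈-++⁺ˡ; ∈-++⁺ʳ; ∈-map⁺; ∈-filter⁺; ∈-filter⁻; ∈-deduplicate⁺; ∈-deduplicate⁻)
open import Data.List.Properties using (length-removeAt′)
open import Data.List.Relation.Binary.Disjoint.Propositional using (Disjoint)
import Data.List.Relation.Binary.Subset.Propositional as List
open import Data.List.Relation.Binary.Subset.Propositional.Properties using (Any-resp-⊆; xs⊆x∷xs; ++⁺ʳ)
import Data.List.Relation.Unary.All as All
open import Data.List.Relation.Unary.All using ([]; _∷_)
open import Data.List.Relation.Unary.All.Properties using (¬Any⇒All¬) renaming (++⁺ to All-++⁺)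
open import Data.List.Relation.Unary.Any as Any using (Any; here; there; index; any?)
open import Data.List.Relation.Unary.Unique.Propositional using (Unique; []; _∷_)
import Data.List.Relation.Unary.Unique.Propositional.Properties as Unique
open import Data.List.Relation.Unary.Unique.DecPropositional.Properties using (deduplicate-!)
open import Data.Nat using (zero; suc; _+_; _≤_; _<_; z≤n; s≤s)
open import Data.Nat.Properties
  using ( +-suc; +-cancelˡ-≡; suc-injective; <-irrefl; ≤-refl; ≤-trans; ≤-reflexive; ≤-antisym
        ; ≤-pred; ≤∧≢⇒<; m≤m+n; module ≤-Reasoning )
  renaming (_≟_ to _≟ℕ_)
open import Data.Product using (∃₂; _,_; proj₁; proj₂)
import Data.Product as Product
open import Data.Sum using (inj₁; inj₂; [_,_]; assocʳ)
import Data.Sum as Sum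
open import Data.Unit using (tt) renaming (⊤ to Unit)
open import Data.Vec using (_∷_; [])
import Data.Vec as Vec
open import Data.Vec.Properties using (≡-dec)
open import Function using (_∘_)
open import Relation.Binary.Definitions using (DecidableEquality)
open import Relation.Binary.PropositionalEquality
  using (_≢_; refl; sym; trans; cong; subst; subst₂; module ≡-Reasoning)
open import Relation.Nullary using (¬_; Dec; yes; no; ¬?; contradiction)
open import Relation.Nullary.Decidable using (_×-dec_; _⊎-dec_; _→-dec_; map′)
open import Relation.Unary using (Pred; Decidable)

private variable
  n k : ℕ
  p q r : Subset n

DisjointUnion : Subset n → Subset n → Subset n → Set
DisjointUnion r p q = Empty (p ∩ q) × r ≡ p ∪ q

Empty-outside∷ : Empty p → Empty (outside ∷ p)
Empty-outside∷ e (suc x , Vec.there x∈p) = e (x , x∈p)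

∣p∪q∣≡∣p∣+∣q∣ : ∀ (p q : Subset n) → Empty (p ∩ q) → ∣ p ∪ q ∣ ≡ ∣ p ∣ + ∣ q ∣
∣p∪q∣≡∣p∣+∣q∣ []          []          _ = refl
∣p∪q∣≡∣p∣+∣q∣ (true ∷ p)  (true ∷ q)  e = ⊥-elim (e (zero , Vec.here))
∣p∪q∣≡∣p∣+∣q∣ (true ∷ p)  (false ∷ q) e = cong suc (∣p∪q∣≡∣p∣+∣q∣ p q (drop-∷-Empty e))
∣p∪q∣≡∣p∣+∣q∣ (false ∷ p) (true ∷ q)  e =
  trans (cong suc (∣p∪q∣≡∣p∣+∣q∣ p q (drop-∷-Empty e))) (sym (+-suc ∣ p ∣ ∣ q ∣))
∣p∪q∣≡∣p∣+∣q∣ (false ∷ p) (false ∷ q) e = ∣p∪q∣≡∣p∣+∣q∣ p q (drop-∷-Empty e)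

∣DisjointUnion∣ : DisjointUnion r p q → ∣ r ∣ ≡ ∣ p ∣ + ∣ q ∣
∣DisjointUnion∣ {p = p} {q} (e , refl) = ∣p∪q∣≡∣p∣+∣q∣ p q e

∣DisjointUnion∣ʳ : ∀ {m} → DisjointUnion r p q → ∣ r ∣ ≡ ∣ p ∣ + m → ∣ q ∣ ≡ m
∣DisjointUnion∣ʳ {p = p} du e = +-cancelˡ-≡ ∣ p ∣ _ _ (trans (sym (∣DisjointUnion∣ du)) e)

DisjointUnion-⊆ˡ : DisjointUnion r p q → p ⊆ r
DisjointUnion-⊆ˡ {q = q} (_ , refl) = p⊆p∪q q

DisjointUnion-⊆ʳ : DisjointUnion r p q → q ⊆ r
DisjointUnion-⊆ʳ {p = p} {q} (_ , refl) = q⊆p∪q p q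

DisjointUnion? : ∀ (r p q : Subset n) → Dec (DisjointUnion r p q)
DisjointUnion? r p q = ¬? (nonempty? (p ∩ q)) ×-dec ≡-dec Bool._≟_ r (p ∪ q)

⊆⇒DisjointUnion-─ : p ⊆ q → DisjointUnion q p (q ─ p)
⊆⇒DisjointUnion-─ {p = []}        {[]}        _   = (λ ()) , refl
⊆⇒DisjointUnion-─ {p = true ∷ p}  {true ∷ q}  p⊆q with ⊆⇒DisjointUnion-─ (drop-∷-⊆ p⊆q)
... | e , eq = Empty-outside∷ e , cong (true ∷_) eq
⊆⇒DisjointUnion-─ {p = true ∷ p}  {false ∷ q} p⊆q with p⊆q Vec.here
... | ()
⊆⇒DisjointUnion-─ {p = false ∷ p} {b ∷ q}     p⊆q with ⊆⇒DisjointUnion-─ (drop-∷-⊆ p⊆q)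
... | e , eq = Empty-outside∷ e , cong (b ∷_) eq

∣p∣≡0⇒p≡⊥ : ∀ (p : Subset n) → ∣ p ∣ ≡ 0 → p ≡ ⊥
∣p∣≡0⇒p≡⊥ []          _ = refl
∣p∣≡0⇒p≡⊥ (false ∷ p) e = cong (false ∷_) (∣p∣≡0⇒p≡⊥ p e)

∣p∣≡1⇒p≡⁅x⁆ : ∀ (p : Subset n) → ∣ p ∣ ≡ 1 → ∃[ x ] p ≡ ⁅ x ⁆
∣p∣≡1⇒p≡⁅x⁆ (true ∷ p)  e = zero , cong (true ∷_) (∣p∣≡0⇒p≡⊥ p (suc-injective e))
∣p∣≡1⇒p≡⁅x⁆ (false ∷ p) e with ∣p∣≡1⇒p≡⁅x⁆ p e
... | x , refl = suc x , refl

∃⊆-ofSize : ∀ {k} (p : Subset n) → k ≤ ∣ p ∣ → ∃[ q ] (q ⊆ p × ∣ q ∣ ≡ k)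
∃⊆-ofSize {n} {zero}  p           _        = ⊥ , ⊥⊆ , ∣⊥∣≡0 n
∃⊆-ofSize {k = suc _} (true ∷ p)  (s≤s k≤) with ∃⊆-ofSize p k≤
... | q , q⊆p , refl = true ∷ q , in⊆in q⊆p , refl
∃⊆-ofSize {k = suc _} (false ∷ p) k≤       with ∃⊆-ofSize p k≤
... | q , q⊆p , e = false ∷ q , out⊆ q⊆p , e

⊆∧∣q∣≡∣p∣+1⇒DisjointUnion-⁅⁆ : p ⊆ q → ∣ q ∣ ≡ ∣ p ∣ + 1 → ∃[ x ] DisjointUnion q p ⁅ x ⁆
⊆∧∣q∣≡∣p∣+1⇒DisjointUnion-⁅⁆ {p = p} {q} p⊆q e
  with du ← ⊆⇒DisjointUnion-─ p⊆q
  with ∣p∣≡1⇒p≡⁅x⁆ (q ─ p) (∣DisjointUnion∣ʳ du e)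
... | x , q─p≡⁅x⁆ = x , subst (DisjointUnion q p) q─p≡⁅x⁆ du

∣p∣≡2⇒DisjointUnion-⁅⁆-⁅⁆ : ∀ (p : Subset n) → ∣ p ∣ ≡ 2 → ∃₂ λ x y → DisjointUnion p ⁅ x ⁆ ⁅ y ⁆
∣p∣≡2⇒DisjointUnion-⁅⁆-⁅⁆ p e with ∃⊆-ofSize p (subst (1 ≤_) (sym e) (s≤s z≤n))
... | q , q⊆p , ∣q∣≡1 with ∣p∣≡1⇒p≡⁅x⁆ q ∣q∣≡1
... | x , refl = x , ⊆∧∣q∣≡∣p∣+1⇒DisjointUnion-⁅⁆ q⊆p (trans e (cong (_+ 1) (sym ∣q∣≡1)))

⊆⇒≡⊎⊂ : p ⊆ q → p ≡ q ⊎ p ⊂ q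
⊆⇒≡⊎⊂ {p = []}        {[]}        _   = inj₁ refl
⊆⇒≡⊎⊂ {p = true ∷ p}  {false ∷ q} p⊆q with p⊆q Vec.here
... | ()
⊆⇒≡⊎⊂ {p = false ∷ p} {true ∷ q}  p⊆q = inj₂ (out⊂in (drop-∷-⊆ p⊆q))
⊆⇒≡⊎⊂ {p = true ∷ p}  {true ∷ q}  p⊆q = Sum.map (cong (true ∷_)) s⊂s (⊆⇒≡⊎⊂ (drop-∷-⊆ p⊆q))
⊆⇒≡⊎⊂ {p = false ∷ p} {false ∷ q} p⊆q = Sum.map (cong (false ∷_)) s⊂s (⊆⇒≡⊎⊂ (drop-∷-⊆ p⊆q))

⊆∧∣p∣<∣q∣⇒⊂ : p ⊆ q → ∣ p ∣ < ∣ q ∣ → p ⊂ q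
⊆∧∣p∣<∣q∣⇒⊂ p⊆q ∣p∣<∣q∣ with ⊆⇒≡⊎⊂ p⊆q
... | inj₁ refl = ⊥-elim (<-irrefl refl ∣p∣<∣q∣)
... | inj₂ p⊂q  = p⊂q

⊆∧∣p∣≡∣q∣⇒≡ : p ⊆ q → ∣ p ∣ ≡ ∣ q ∣ → p ≡ q
⊆∧∣p∣≡∣q∣⇒≡ p⊆q ∣p∣≡∣q∣ with ⊆⇒≡⊎⊂ p⊆q
... | inj₁ p≡q = p≡q
... | inj₂ p⊂q = ⊥-elim (<-irrefl ∣p∣≡∣q∣ (p⊂q⇒∣p∣<∣q∣ p⊂q))

⊆⇒∩≡ : p ⊆ q → q ∩ p ≡ p
⊆⇒∩≡ {p = p} {q} p⊆q = ⊆-antisym (p∩q⊆q q p) (λ x∈p → x∈p∩q⁺ (p⊆q x∈p , x∈p))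

infix 4 _≟ₛ_
_≟ₛ_ : DecidableEquality (Subset n)
_≟ₛ_ = ≡-dec Bool._≟_

allSubsets : ∀ n → List (Subset n)
allSubsets zero    = [] ∷ []
allSubsets (suc n) = map (true ∷_) (allSubsets n) ++ map (false ∷_) (allSubsets n)

∈-allSubsets : ∀ (p : Subset n) → p ∈ allSubsets n
∈-allSubsets []          = here refl
∈-allSubsets (true ∷ p)  = ∈-++⁺ˡ (∈-map⁺ (true ∷_) (∈-allSubsets p))
∈-allSubsets {suc n} (false ∷ p) = ∈-++⁺ʳ (map (true ∷_) (allSubsets n)) (∈-map⁺ (false ∷_) (∈-allSubsets p))

module _ {A : Set} where

  ∈-─ : ∀ {x y : A} {ys} (x∈ys : x ∈ ys) → y ∈ ys → y ≢ x → y ∈ (ys Any.─ x∈ys)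
  ∈-─ (here refl)  (here refl)  y≢x = ⊥-elim (y≢x refl)
  ∈-─ (here refl)  (there y∈ys) _   = y∈ys
  ∈-─ (there _)    (here refl)  _   = here refl
  ∈-─ (there x∈ys) (there y∈ys) y≢x = there (∈-─ x∈ys y∈ys y≢x)

  Unique∧⊆⇒length≤ : ∀ {xs ys : List A} → Unique xs → xs List.⊆ ys → length xs ≤ length ys
  Unique∧⊆⇒length≤ [] _ = z≤n
  Unique∧⊆⇒length≤ {x ∷ xs} {ys} (x∉xs ∷ u) xs⊆ys = ≤-trans
    (s≤s (Unique∧⊆⇒length≤ u λ y∈xs →
       ∈-─ x∈ys (xs⊆ys (there y∈xs)) λ { refl → All.lookup x∉xs y∈xs refl }))
    (≤-reflexive (sym (length-removeAt′ ys (index x∈ys))))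
    where x∈ys = xs⊆ys (here refl)

  length-++-monoʳ : ∀ (zs : List A) {xs ys} → length xs ≤ length ys → length (zs ++ xs) ≤ length (zs ++ ys)
  length-++-monoʳ []       xs≤ys = xs≤ys
  length-++-monoʳ (_ ∷ zs) xs≤ys = s≤s (length-++-monoʳ zs xs≤ys)

  All¬⇒Disjoint : ∀ {ℓ} {P : Pred A ℓ} {xs ys} → All P xs → All (¬_ ∘ P) ys → Disjoint xs ys
  All¬⇒Disjoint Pxs ¬Pys (v∈xs , v∈ys) = All.lookup ¬Pys v∈ys (All.lookup Pxs v∈xs)

  sublists : List A → List (List A)
  sublists []       = [] ∷ []
  sublists (x ∷ xs) = map (x ∷_) (sublists xs) ++ sublists xs

  filter∈sublists : ∀ {ℓ} {P : Pred A ℓ} (P? : Decidable P) xs → filter P? xs ∈ sublists xs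
  filter∈sublists P? []       = here refl
  filter∈sublists P? (x ∷ xs) with P? x
  ... | yes _ = ∈-++⁺ˡ (∈-map⁺ (x ∷_) (filter∈sublists P? xs))
  ... | no  _ = ∈-++⁺ʳ (map (x ∷_) (sublists xs)) (filter∈sublists P? xs)

  module _ (_≟_ : DecidableEquality A) {ℓ} {P : Pred A ℓ} (P? : Decidable P) where

    enumerate : List A → List A
    enumerate = deduplicate _≟_ ∘ filter P?

    ∈-enumerate⁺ : ∀ {x xs} → x ∈ xs → P x → x ∈ enumerate xs
    ∈-enumerate⁺ x∈xs px = ∈-deduplicate⁺ _≟_ (∈-filter⁺ P? x∈xs px)

    ∈-enumerate⁻ : ∀ {x} xs → x ∈ enumerate xs → x ∈ xs × P x
    ∈-enumerate⁻ xs x∈ = ∈-filter⁻ P? (∈-deduplicate⁻ _≟_ (filter P? xs) x∈)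

    enumerate-Unique : ∀ xs → Unique (enumerate xs)
    enumerate-Unique xs = deduplicate-! _≟_ (filter P? xs)

OfSize : ℕ → List (Subset n) → Set
OfSize k = All (λ p → ∣ p ∣ ≡ k)

allPairs : ∀ n → List (Subset n)
allPairs n = enumerate _≟ₛ_ (λ p → ∣ p ∣ ≟ℕ 2) (allSubsets n)

∈-allPairs : ∣ p ∣ ≡ 2 → p ∈ allPairs n
∈-allPairs {p = p} = ∈-enumerate⁺ _≟ₛ_ (λ p → ∣ p ∣ ≟ℕ 2) (∈-allSubsets p)

allPairs-ofSize : OfSize 2 (allPairs n)
allPairs-ofSize {n} = All.tabulate (proj₂ ∘ ∈-enumerate⁻ _≟ₛ_ (λ p → ∣ p ∣ ≟ℕ 2) (allSubsets n))

OfSize⇒≢ : ∀ {a b} {ps : List (Subset n)} → OfSize a ps → a ≢ b → All (λ p → ∣ p ∣ ≢ b) ps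
OfSize⇒≢ ∣ps∣≡a a≢b = All.map (λ ∣p∣≡a ∣p∣≡b → a≢b (trans (sym ∣p∣≡a) ∣p∣≡b)) ∣ps∣≡a

allPairs-Unique : Unique (allPairs n)
allPairs-Unique {n} = enumerate-Unique _≟ₛ_ (λ p → ∣ p ∣ ≟ℕ 2) (allSubsets n)

-- Circuits

a≡2+m⇒2≤a : ∀ {a m} → a ≡ 2 + m → 2 ≤ a
a≡2+m⇒2≤a refl = m≤m+n 2 _

+≡3⇒ : ∀ a {b} → 1 ≤ a → 1 ≤ b → a + b ≡ 3 → a ≡ 2 ⊎ b ≡ 2
+≡3⇒ 1 _ _       e = inj₂ (suc-injective e)
+≡3⇒ 2 _ _       _ = inj₁ refl
+≡3⇒ 3 _ (s≤s _) ()
+≡3⇒ (suc (suc (suc (suc _)))) _ _ ()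

+≡4⇒ : ∀ a {b} → 1 ≤ a → 1 ≤ b → a + b ≡ 4 → (a ≡ 2 × b ≡ 2) ⊎ a ≡ 3 ⊎ b ≡ 3
+≡4⇒ 1 _ _       e = inj₂ (inj₂ (suc-injective e))
+≡4⇒ 2 _ _       e = inj₁ (refl , suc-injective (suc-injective e))
+≡4⇒ 3 _ _       _ = inj₂ (inj₁ refl)
+≡4⇒ 4 _ (s≤s _) ()
+≡4⇒ (suc (suc (suc (suc (suc _))))) _ _ ()

gateSets : Gates n k → List (Subset n)
gateSets []            = []
gateSets (g ▷ (a , b)) = S g a ∪ S g b ∷ gateSets g

length-gateSets : (g : Gates n k) → length (gateSets g) ≡ k
length-gateSets []      = refl
length-gateSets (g ▷ _) = cong suc (length-gateSets g)

VertexSet : Gates n k → Subset n → Set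
VertexSet g X = ∃[ v ] S g v ≡ X

record Gate (g : Gates n k) (X : Subset n) : Set where
  constructor gate
  field
    X∈gateSets   : X ∈ gateSets g
    left right   : Subset n
    left-vertex  : VertexSet g left
    right-vertex : VertexSet g right
    split        : DisjointUnion X left right

VertexSet-▷ : ∀ {g : Gates n k} {ab X} → VertexSet g X → VertexSet (g ▷ ab) X
VertexSet-▷ (v , e) = suc v , e

Gate-▷ : ∀ {g : Gates n k} {ab X} → Gate g X → Gate (g ▷ ab) X
Gate-▷ (gate m Y Z vY vZ du) = gate (there m) Y Z (VertexSet-▷ vY) (VertexSet-▷ vZ) du

input-or-gate : (g : Gates n k) → Valid g → (v : Fin (k + n)) → (∃[ i ] S g v ≡ ⁅ i ⁆) ⊎ Gate g (S g v)
input-or-gate []            _         v       = inj₁ (v , refl)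
input-or-gate (g ▷ (a , b)) (_ , a∩b) zero    = inj₂ (gate (here refl) _ _ (suc a , refl) (suc b , refl) (a∩b , refl))
input-or-gate (g ▷ _)       (valid , _) (suc v) = Sum.map₂ Gate-▷ (input-or-gate g valid v)

VertexSet-nonempty : (g : Gates n k) → ∀ {X} → VertexSet g X → 1 ≤ ∣ X ∣
VertexSet-nonempty []            (v       , refl) = ≤-reflexive (sym (∣⁅x⁆∣≡1 v))
VertexSet-nonempty (g ▷ (a , b)) (zero    , refl) = ≤-trans (VertexSet-nonempty g (a , refl)) (∣p∣≤∣p∪q∣ (S g a) (S g b))
VertexSet-nonempty (g ▷ _)       (suc v   , refl) = VertexSet-nonempty g (v , refl)

module _ {g : Gates n k} (valid : Valid g) where

  VertexSet⇒Gate : ∀ {X} → VertexSet g X → 2 ≤ ∣ X ∣ → Gate g X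
  VertexSet⇒Gate (v , refl) 2≤∣X∣ with input-or-gate g valid v
  ... | inj₂ G       = G
  ... | inj₁ (i , e) = ⊥-elim (<-irrefl refl (subst (2 ≤_) (trans (cong ∣_∣ e) (∣⁅x⁆∣≡1 i)) 2≤∣X∣))

  VertexSet⇒gate : ∀ {X} → VertexSet g X → 2 ≤ ∣ X ∣ → X ∈ gateSets g
  VertexSet⇒gate vX = Gate.X∈gateSets ∘ VertexSet⇒Gate vX

  ∣Gate∣ : ∀ {X} (G : Gate g X) → ∣ X ∣ ≡ ∣ Gate.left G ∣ + ∣ Gate.right G ∣
  ∣Gate∣ G = ∣DisjointUnion∣ (Gate.split G)

  triple⇒pair-gate : ∀ {X} → VertexSet g X → ∣ X ∣ ≡ 3 → ∃[ A ] (A ∈ gateSets g × ∣ A ∣ ≡ 2 × A ⊆ X)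
  triple⇒pair-gate vX ∣X∣≡3
    with G@(gate _ Y Z vY vZ du) ← VertexSet⇒Gate vX (a≡2+m⇒2≤a ∣X∣≡3)
    with +≡3⇒ ∣ Y ∣ (VertexSet-nonempty g vY) (VertexSet-nonempty g vZ) (trans (sym (∣Gate∣ G)) ∣X∣≡3)
  ... | inj₁ ∣Y∣≡2 = Y , VertexSet⇒gate vY (a≡2+m⇒2≤a ∣Y∣≡2) , ∣Y∣≡2 , DisjointUnion-⊆ˡ du
  ... | inj₂ ∣Z∣≡2 = Z , VertexSet⇒gate vZ (a≡2+m⇒2≤a ∣Z∣≡2) , ∣Z∣≡2 , DisjointUnion-⊆ʳ du

  data QuadSplit (T : Subset n) : Set where
    two-pairs  : ∀ {A B} → A ∈ gateSets g → B ∈ gateSets g → ∣ A ∣ ≡ 2 → ∣ B ∣ ≡ 2 →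
                 DisjointUnion T A B → QuadSplit T
    via-triple : ∀ {X A B} → X ∈ gateSets g → ∣ X ∣ ≡ 3 → X ⊆ T → A ∈ gateSets g → ∣ A ∣ ≡ 2 → ∣ B ∣ ≡ 2 →
                 DisjointUnion T A B → QuadSplit T

  triple⊆⇒QuadSplit : ∀ {X T} → VertexSet g X → ∣ X ∣ ≡ 3 → X ⊆ T → ∣ T ∣ ≡ 4 → QuadSplit T
  triple⊆⇒QuadSplit vX ∣X∣≡3 X⊆T ∣T∣≡4 with triple⇒pair-gate vX ∣X∣≡3
  ... | A , A∈gates , ∣A∣≡2 , A⊆X =
    via-triple (VertexSet⇒gate vX (a≡2+m⇒2≤a ∣X∣≡3)) ∣X∣≡3 X⊆T A∈gates ∣A∣≡2
               (∣DisjointUnion∣ʳ du (trans ∣T∣≡4 (cong (_+ 2) (sym ∣A∣≡2)))) du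
    where du = ⊆⇒DisjointUnion-─ (⊆-trans A⊆X X⊆T)

  quadSplit : ∀ {T} → VertexSet g T → ∣ T ∣ ≡ 4 → QuadSplit T
  quadSplit vT ∣T∣≡4
    with G@(gate _ Y Z vY vZ du) ← VertexSet⇒Gate vT (a≡2+m⇒2≤a ∣T∣≡4)
    with +≡4⇒ ∣ Y ∣ (VertexSet-nonempty g vY) (VertexSet-nonempty g vZ) (trans (sym (∣Gate∣ G)) ∣T∣≡4)
  ... | inj₁ (∣Y∣≡2 , ∣Z∣≡2) = two-pairs (VertexSet⇒gate vY (a≡2+m⇒2≤a ∣Y∣≡2))
                                          (VertexSet⇒gate vZ (a≡2+m⇒2≤a ∣Z∣≡2)) ∣Y∣≡2 ∣Z∣≡2 du
  ... | inj₂ (inj₁ ∣Y∣≡3) = triple⊆⇒QuadSplit vY ∣Y∣≡3 (DisjointUnion-⊆ˡ du) ∣T∣≡4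
  ... | inj₂ (inj₂ ∣Z∣≡3) = triple⊆⇒QuadSplit vZ ∣Z∣≡3 (DisjointUnion-⊆ʳ du) ∣T∣≡4

Available : List (Subset n) → Subset n → Set
Available Xs Y = Y ∈ Xs ⊎ ∃[ i ] Y ≡ ⁅ i ⁆

Derivable : List (Subset n) → Subset n → Set
Derivable Xs X = ∃₂ λ Y Z → Available Xs Y × Available Xs Z × DisjointUnion X Y Z ×
                            (∣ X ∣ ≡ 4 → ∣ Y ∣ ≡ 2 × ∣ Z ∣ ≡ 2)

-- Newest gate first, as in Gates.
Schedule : List (Subset n) → Set
Schedule []       = Unit
Schedule (X ∷ Xs) = Derivable Xs X × Schedule Xs

Derivable-++ : ∀ {Ys : List (Subset n)} {X} Xs → Derivable Ys X → Derivable (Xs ++ Ys) X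
Derivable-++ {Ys = Ys} Xs (Y , Z , aY , aZ , du , depth2) = Y , Z , weaken aY , weaken aZ , du , depth2
  where
  weaken : ∀ {W} → Available Ys W → Available (Xs ++ Ys) W
  weaken = Sum.map₁ (∈-++⁺ʳ Xs)

Schedule-++ : ∀ {Ys : List (Subset n)} Xs → All (Derivable Ys) Xs → Schedule Ys → Schedule (Xs ++ Ys)
Schedule-++ []       []       s = s
Schedule-++ (X ∷ Xs) (d ∷ ds) s = Derivable-++ Xs d , Schedule-++ Xs ds s

realise : (Xs : List (Subset n)) → Schedule Xs →
          Σ (Gates n (length Xs)) λ g → Valid g × Depth2Gates g × (∀ {Y} → Available Xs Y → VertexSet g Y)
realise []       _ = [] , tt , tt , λ { (inj₂ (i , refl)) → i , refl }
realise (X ∷ Xs) ((Y , Z , aY , aZ , (Y∩Z , refl) , depth2) , s)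
  with g , valid , depth2s , vertex ← realise Xs s
  with a , refl ← vertex aY
  with b , refl ← vertex aZ
  = g ▷ (a , b) , (valid , Y∩Z) , (depth2s , depth2) , λ where
      (inj₁ (here refl))  → zero , refl
      (inj₁ (there Y∈Xs)) → VertexSet-▷ (vertex (inj₁ Y∈Xs))
      (inj₂ Y≡⁅i⁆)        → VertexSet-▷ (vertex (inj₂ Y≡⁅i⁆))

module _ {Xs : List (Subset n)} where

  pair-Derivable : ∀ {P} → ∣ P ∣ ≡ 2 → Derivable Xs P
  pair-Derivable {P} ∣P∣≡2 with x , y , du ← ∣p∣≡2⇒DisjointUnion-⁅⁆-⁅⁆ P ∣P∣≡2 =
    ⁅ x ⁆ , ⁅ y ⁆ , inj₂ (x , refl) , inj₂ (y , refl) , du ,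
    λ ∣P∣≡4 → contradiction (trans (sym ∣P∣≡2) ∣P∣≡4) λ ()

  triple-Derivable : ∀ {A Q} → A ∈ Xs → A ⊆ Q → ∣ A ∣ ≡ 2 → ∣ Q ∣ ≡ 3 → Derivable Xs Q
  triple-Derivable {A} A∈Xs A⊆Q ∣A∣≡2 ∣Q∣≡3
    with x , du ← ⊆∧∣q∣≡∣p∣+1⇒DisjointUnion-⁅⁆ A⊆Q (trans ∣Q∣≡3 (cong (_+ 1) (sym ∣A∣≡2))) =
    A , ⁅ x ⁆ , inj₁ A∈Xs , inj₂ (x , refl) , du ,
    λ ∣Q∣≡4 → contradiction (trans (sym ∣Q∣≡3) ∣Q∣≡4) λ ()

  pairs-Derivable : ∀ {A B T} → A ∈ Xs → B ∈ Xs → ∣ A ∣ ≡ 2 → ∣ B ∣ ≡ 2 → DisjointUnion T A B → Derivable Xs T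
  pairs-Derivable {A} {B} A∈Xs B∈Xs ∣A∣≡2 ∣B∣≡2 du = A , B , inj₁ A∈Xs , inj₁ B∈Xs , du , λ _ → ∣A∣≡2 , ∣B∣≡2

Schedule-pairs : ∀ {Ps : List (Subset n)} → OfSize 2 Ps → Schedule Ps
Schedule-pairs []                = tt
Schedule-pairs (∣P∣≡2 ∷ ∣Ps∣≡2) = pair-Derivable ∣P∣≡2 , Schedule-pairs ∣Ps∣≡2

-- The intersection loop

module _ (𝒯 : List (Subset n)) where

  IntersectStep-antitone : ∀ {B B′ : Fam n} {L} → (∀ {X} → B X → B′ X) → IntersectStep 𝒯 B′ L → IntersectStep 𝒯 B L
  IntersectStep-antitone B⊆B′ (ℓ≥3 , unique , fresh , ∣⋂∣≡3) =
    ℓ≥3 , unique , All.map (Product.map₂ (_∘ B⊆B′)) fresh , ∣⋂∣≡3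

  IntersectRun-exhaustive : ∀ {B R} → IntersectRun 𝒯 B R → ∀ L → ¬ IntersectStep 𝒯 (λ X → B X ⊎ R X) L
  IntersectRun-exhaustive (done stuck)  L = stuck L ∘ IntersectStep-antitone inj₁
  IntersectRun-exhaustive (step _ _ run) L = IntersectRun-exhaustive run L ∘ IntersectStep-antitone assocʳ

  IntersectRun-decidable : ∀ {B R} → IntersectRun 𝒯 B R → Decidable R
  IntersectRun-decidable (done _)       X = no λ ()
  IntersectRun-decidable (step L _ run) X = (X ∈? L) ⊎-dec IntersectRun-decidable run X
    where open import Data.List.Membership.DecPropositional _≟ₛ_ using (_∈?_)

-- The instance 𝒯^{depth≤2}

module Instance (𝒯 : List (Subset n)) (𝒯int : Fam n) (run : IntersectRun 𝒯 (𝒯⊋3 𝒯) 𝒯int)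
                (M : List (Subset n × Subset n)) (maxM : IsMaxMatching 𝒯 𝒯int M) where

  open import Data.List.Membership.DecPropositional (_≟ₛ_ {n}) using (_∈?_)

  F : Fam n
  F = 𝒯depth≤2 𝒯 𝒯int M

  𝒯₃′-members : Fam n
  𝒯₃′-members = 𝒯₃′ 𝒯 𝒯int M

  𝒯₄depth2-members : Fam n
  𝒯₄depth2-members = 𝒯₄depth2 𝒯 𝒯int M

  matched-edge : ∀ {Y Z} → (Y , Z) ∈ M → GEdge 𝒯 𝒯int Y Z
  matched-edge = All.lookup (proj₁ (proj₁ maxM))

  endpoints-∈ : ∀ {M′ Y Z} → (Y , Z) ∈ M′ → Unique (endpoints 𝒯 𝒯int M′) →
                Y ∈ endpoints 𝒯 𝒯int M′ × Z ∈ endpoints 𝒯 𝒯int M′ × Y ≢ Z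
  endpoints-∈ (here refl) ((Y≢Z ∷ _) ∷ _)   = here refl , there (here refl) , Y≢Z
  endpoints-∈ (there YZ∈M′) (_ ∷ _ ∷ unique) =
    Product.map (there ∘ there) (Product.map₁ (there ∘ there)) (endpoints-∈ YZ∈M′ unique)

  ∣𝒯₃′∣ : ∀ {X} → 𝒯₃′-members X → ∣ X ∣ ≡ 3
  ∣𝒯₃′∣ (inj₁ (_ , ∣X∣≡3))           = ∣X∣≡3
  ∣𝒯₃′∣ (inj₂ (_ , _ , YZ∈M , refl)) = proj₂ (proj₂ (matched-edge YZ∈M))

  ∣𝒯₄depth2∣ : ∀ {X} → 𝒯₄depth2-members X → ∣ X ∣ ≡ 4
  ∣𝒯₄depth2∣ = proj₂ ∘ proj₁

  F⇒2≤∣X∣ : ∀ {X} → F X → 2 ≤ ∣ X ∣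
  F⇒2≤∣X∣ (inj₁ (_ , ∣X∣≡2)) = a≡2+m⇒2≤a ∣X∣≡2
  F⇒2≤∣X∣ (inj₂ (inj₁ q))     = a≡2+m⇒2≤a (∣𝒯₃′∣ q)
  F⇒2≤∣X∣ (inj₂ (inj₂ d))     = a≡2+m⇒2≤a (∣𝒯₄depth2∣ d)

  -- A member of 𝒯₃ inside T would put T in 𝒯^{⊋3}; an intersection Y ∩ Z ⊆ T of a matching
  -- edge would let the intersection loop continue with T, Y, Z.
  𝒯₄depth2-∌-𝒯₃′ : ∀ {T X} → 𝒯₄depth2-members T → 𝒯₃′-members X → ¬ X ⊆ T
  𝒯₄depth2-∌-𝒯₃′ (T₄ , T∉⊋3 , _ , _) (inj₁ X₃) X⊆T =
    T∉⊋3 (T₄ , _ , X₃ , ⊆∧∣p∣<∣q∣⇒⊂ X⊆T (subst₂ _<_ (sym (proj₂ X₃)) (sym (proj₂ T₄)) ≤-refl))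
  𝒯₄depth2-∌-𝒯₃′ {T} (T₄ , T∉⊋3 , T∉int , T∉M) (inj₂ (Y , Z , YZ∈M , refl)) Y∩Z⊆T
    with (Y₄ , Y∉⊋3 , Y∉int) , (Z₄ , Z∉⊋3 , Z∉int) , ∣Y∩Z∣≡3 ← matched-edge YZ∈M
    with Y∈M , Z∈M , Y≢Z ← endpoints-∈ YZ∈M (proj₂ (proj₁ maxM))
    = IntersectRun-exhaustive 𝒯 run (T ∷ Y ∷ Z ∷ [])
        ( ≤-refl
        , ((λ { refl → T∉M Y∈M }) ∷ (λ { refl → T∉M Z∈M }) ∷ []) ∷ (Y≢Z ∷ []) ∷ [] ∷ []
        , (T₄ , [ T∉⊋3 , T∉int ]) ∷ (Y₄ , [ Y∉⊋3 , Y∉int ]) ∷ (Z₄ , [ Z∉⊋3 , Z∉int ]) ∷ []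
        , ∣T∩Y∩Z∣≡3 )
    where
    open ≡-Reasoning
    ∣T∩Y∩Z∣≡3 : ∣ T ∩ (Y ∩ (Z ∩ ⊤)) ∣ ≡ 3
    ∣T∩Y∩Z∣≡3 = begin
      ∣ T ∩ (Y ∩ (Z ∩ ⊤)) ∣ ≡⟨ cong (λ W → ∣ T ∩ (Y ∩ W) ∣) (∩-identityʳ Z) ⟩
      ∣ T ∩ (Y ∩ Z) ∣                      ≡⟨ cong ∣_∣ (⊆⇒∩≡ Y∩Z⊆T) ⟩
      ∣ Y ∩ Z ∣                            ≡⟨ ∣Y∩Z∣≡3 ⟩
      3                                    ∎

  -- Otherwise the edge {T, T′} would extend the maximum matching.
  𝒯₄depth2-shared-triple⇒≡ : ∀ {T T′ X} → 𝒯₄depth2-members T → 𝒯₄depth2-members T′ →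
                          X ⊆ T → X ⊆ T′ → ∣ X ∣ ≡ 3 → T ≡ T′
  𝒯₄depth2-shared-triple⇒≡ {T} {T′} (T₄ , T∉⊋3 , T∉int , T∉M) (T′₄ , T′∉⊋3 , T′∉int , T′∉M) X⊆T X⊆T′ ∣X∣≡3
    with T ≟ₛ T′
  ... | yes T≡T′ = T≡T′
  ... | no  T≢T′ = ⊥-elim (<-irrefl refl (proj₂ maxM ((T , T′) ∷ M) extended))
    where
    ∣T∩T′∣≢4 : ∣ T ∩ T′ ∣ ≢ 4
    ∣T∩T′∣≢4 ∣T∩T′∣≡4 = T≢T′ (trans
      (sym (⊆∧∣p∣≡∣q∣⇒≡ (p∩q⊆p T T′) (trans ∣T∩T′∣≡4 (sym (proj₂ T₄)))))
      (⊆∧∣p∣≡∣q∣⇒≡ (p∩q⊆q T T′) (trans ∣T∩T′∣≡4 (sym (proj₂ T′₄)))))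

    ∣T∩T′∣≡3 : ∣ T ∩ T′ ∣ ≡ 3
    ∣T∩T′∣≡3 = ≤-antisym
      (≤-pred (≤∧≢⇒< (subst (∣ T ∩ T′ ∣ ≤_) (proj₂ T₄) (∣p∩q∣≤∣p∣ T T′)) ∣T∩T′∣≢4))
      (subst (_≤ ∣ T ∩ T′ ∣) ∣X∣≡3 (p⊆q⇒∣p∣≤∣q∣ λ x∈X → x∈p∩q⁺ (X⊆T x∈X , X⊆T′ x∈X)))

    extended : IsMatching 𝒯 𝒯int ((T , T′) ∷ M)
    extended = ((T₄ , T∉⊋3 , T∉int) , (T′₄ , T′∉⊋3 , T′∉int) , ∣T∩T′∣≡3) ∷ proj₁ (proj₁ maxM)
             , (T≢T′ ∷ ¬Any⇒All¬ _ T∉M) ∷ ¬Any⇒All¬ _ T′∉M ∷ proj₂ (proj₁ maxM)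

  𝒯ₛ? : ∀ i → Decidable (𝒯ₛ 𝒯 i)
  𝒯ₛ? i X = (X ∈? 𝒯) ×-dec (∣ X ∣ ≟ℕ i)

  𝒯⊋3? : Decidable (𝒯⊋3 𝒯)
  𝒯⊋3? X = 𝒯ₛ? 4 X ×-dec map′ from-any to-any (any? (λ Y → (∣ Y ∣ ≟ℕ 3) ×-dec (Y ⊂? X)) 𝒯)
    where
    from-any : Any (λ Y → ∣ Y ∣ ≡ 3 × Y ⊂ X) 𝒯 → ∃[ Y ] (𝒯ₛ 𝒯 3 Y × Y ⊂ X)
    from-any any with Y , Y∈𝒯 , ∣Y∣≡3 , Y⊂X ← find any = Y , (Y∈𝒯 , ∣Y∣≡3) , Y⊂X
    to-any : ∃[ Y ] (𝒯ₛ 𝒯 3 Y × Y ⊂ X) → Any (λ Y → ∣ Y ∣ ≡ 3 × Y ⊂ X) 𝒯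
    to-any (_ , (Y∈𝒯 , ∣Y∣≡3) , Y⊂X) = lose Y∈𝒯 (∣Y∣≡3 , Y⊂X)

  𝒯₄depth2? : Decidable 𝒯₄depth2-members
  𝒯₄depth2? X = 𝒯ₛ? 4 X ×-dec ¬? (𝒯⊋3? X) ×-dec ¬? (IntersectRun-decidable 𝒯 run X)
                ×-dec ¬? (X ∈? endpoints 𝒯 𝒯int M)

  𝒯₃′? : Decidable 𝒯₃′-members
  𝒯₃′? X = 𝒯ₛ? 3 X ⊎-dec map′ from-any to-any (any? (λ (Y , Z) → X ≟ₛ Y ∩ Z) M)
    where
    from-any : Any (λ (Y , Z) → X ≡ Y ∩ Z) M → ∃₂ λ Y Z → (Y , Z) ∈ M × X ≡ Y ∩ Z
    from-any any with (Y , Z) , YZ∈M , X≡Y∩Z ← find any = Y , Z , YZ∈M , X≡Y∩Z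
    to-any : (∃₂ λ Y Z → (Y , Z) ∈ M × X ≡ Y ∩ Z) → Any (λ (Y , Z) → X ≡ Y ∩ Z) M
    to-any (_ , _ , YZ∈M , X≡Y∩Z) = lose YZ∈M X≡Y∩Z

  𝒯₃′-candidates : List (Subset n)
  𝒯₃′-candidates = 𝒯 ++ map (λ (Y , Z) → Y ∩ Z) M

  𝒯₃′-list : List (Subset n)
  𝒯₃′-list = enumerate _≟ₛ_ 𝒯₃′? 𝒯₃′-candidates

  𝒯₄depth2-list : List (Subset n)
  𝒯₄depth2-list = enumerate _≟ₛ_ 𝒯₄depth2? 𝒯

  ∈-𝒯₃′-list⁺ : ∀ {X} → 𝒯₃′-members X → X ∈ 𝒯₃′-list
  ∈-𝒯₃′-list⁺ q@(inj₁ (X∈𝒯 , _))            = ∈-enumerate⁺ _≟ₛ_ 𝒯₃′? (∈-++⁺ˡ X∈𝒯) q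
  ∈-𝒯₃′-list⁺ q@(inj₂ (_ , _ , YZ∈M , refl)) = ∈-enumerate⁺ _≟ₛ_ 𝒯₃′? (∈-++⁺ʳ 𝒯 (∈-map⁺ _ YZ∈M)) q

  ∈-𝒯₃′-list⁻ : ∀ {X} → X ∈ 𝒯₃′-list → 𝒯₃′-members X
  ∈-𝒯₃′-list⁻ = proj₂ ∘ ∈-enumerate⁻ _≟ₛ_ 𝒯₃′? 𝒯₃′-candidates

  ∈-𝒯₄depth2-list⁺ : ∀ {X} → 𝒯₄depth2-members X → X ∈ 𝒯₄depth2-list
  ∈-𝒯₄depth2-list⁺ d = ∈-enumerate⁺ _≟ₛ_ 𝒯₄depth2? (proj₁ (proj₁ d)) d

  ∈-𝒯₄depth2-list⁻ : ∀ {X} → X ∈ 𝒯₄depth2-list → 𝒯₄depth2-members X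
  ∈-𝒯₄depth2-list⁻ = proj₂ ∘ ∈-enumerate⁻ _≟ₛ_ 𝒯₄depth2? 𝒯

  SplitsIn : List (Subset n) → Subset n → Set
  SplitsIn L T = Any (λ A → Any (DisjointUnion T A) L) L

  -- L is the set of pair gates of a canonical circuit, in which every triple is a pair of L
  -- plus an input and every tree of depth 2 is the union of two pairs of L.
  Covers : List (Subset n) → Set
  Covers L = All (λ X → ∣ X ∣ ≡ 2 → X ∈ L) 𝒯
           × All (λ Q → Any (_⊆ Q) L) 𝒯₃′-list
           × All (SplitsIn L) 𝒯₄depth2-list

  Certificate : List (Subset n) → Set
  Certificate L = OfSize 2 L × Covers L

  certificate? : Decidable Certificate
  certificate? L = All.all? (λ P → ∣ P ∣ ≟ℕ 2) L
            ×-dec All.all? (λ X → (∣ X ∣ ≟ℕ 2) →-dec (X ∈? L)) 𝒯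
            ×-dec All.all? (λ Q → any? (_⊆? Q) L) 𝒯₃′-list
            ×-dec All.all? (λ T → any? (λ A → any? (DisjointUnion? T A) L) L) 𝒯₄depth2-list

  SplitsIn-resp-⊆ : ∀ {L L′ T} → L List.⊆ L′ → SplitsIn L T → SplitsIn L′ T
  SplitsIn-resp-⊆ L⊆L′ = Any-resp-⊆ L⊆L′ ∘ Any.map (Any-resp-⊆ L⊆L′)

  Covers-resp-⊆ : ∀ {L L′} → L List.⊆ L′ → Covers L → Covers L′
  Covers-resp-⊆ L⊆L′ (pairs , triples , quads) =
    All.map (L⊆L′ ∘_) pairs , All.map (Any-resp-⊆ L⊆L′) triples , All.map (SplitsIn-resp-⊆ L⊆L′) quads

  cost : List (Subset n) → ℕ
  cost L = length (𝒯₄depth2-list ++ 𝒯₃′-list ++ L)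

  canonical-Schedule : ∀ {L} → Certificate L → Schedule (𝒯₄depth2-list ++ 𝒯₃′-list ++ L)
  canonical-Schedule {L} (∣L∣≡2 , _ , triples , quads) =
    Schedule-++ 𝒯₄depth2-list (All.map quad-from-split quads)
      (Schedule-++ 𝒯₃′-list (All.tabulate triple-from-pair) (Schedule-pairs ∣L∣≡2))
    where
    triple-from-pair : ∀ {Q} → Q ∈ 𝒯₃′-list → Derivable L Q
    triple-from-pair Q∈ with A , A∈L , A⊆Q ← find (All.lookup triples Q∈) =
      triple-Derivable A∈L A⊆Q (All.lookup ∣L∣≡2 A∈L) (∣𝒯₃′∣ (∈-𝒯₃′-list⁻ Q∈))

    quad-from-split : ∀ {T} → SplitsIn L T → Derivable (𝒯₃′-list ++ L) T
    quad-from-split split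
      with A , A∈L , A-split ← find split
      with B , B∈L , du ← find A-split
      = pairs-Derivable (∈-++⁺ʳ 𝒯₃′-list A∈L) (∈-++⁺ʳ 𝒯₃′-list B∈L)
                        (All.lookup ∣L∣≡2 A∈L) (All.lookup ∣L∣≡2 B∈L) du

  canonical : ∀ {L} → Certificate L → Σ (Circuit n) λ C → size C ≡ cost L × IsSolution F C × Depth2 C
  canonical {L} cert@(_ , pairs , _)
    with g , valid , depth2 , vertex ← realise (𝒯₄depth2-list ++ 𝒯₃′-list ++ L) (canonical-Schedule cert)
    = circuit _ g valid , refl , solution , depth2
    where
    solution : IsSolution F (circuit _ g valid)
    solution X (inj₁ (X∈𝒯 , ∣X∣≡2)) =
      vertex (inj₁ (∈-++⁺ʳ 𝒯₄depth2-list (∈-++⁺ʳ 𝒯₃′-list (All.lookup pairs X∈𝒯 ∣X∣≡2))))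
    solution X (inj₂ (inj₁ q)) = vertex (inj₁ (∈-++⁺ʳ 𝒯₄depth2-list (∈-++⁺ˡ (∈-𝒯₃′-list⁺ q))))
    solution X (inj₂ (inj₂ d)) = vertex (inj₁ (∈-++⁺ˡ (∈-𝒯₄depth2-list⁺ d)))

  module LowerBound (C : Circuit n) (solution : IsSolution F C) where

    Γ : List (Subset n)
    Γ = gateSets (gates C)

    Γ₂ : List (Subset n)
    Γ₂ = enumerate _≟ₛ_ (λ P → ∣ P ∣ ≟ℕ 2) Γ

    ∈-Γ₂⁺ : ∀ {P} → P ∈ Γ → ∣ P ∣ ≡ 2 → P ∈ Γ₂
    ∈-Γ₂⁺ = ∈-enumerate⁺ _≟ₛ_ (λ P → ∣ P ∣ ≟ℕ 2)

    ∈-Γ₂⁻ : ∀ {P} → P ∈ Γ₂ → P ∈ Γ × ∣ P ∣ ≡ 2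
    ∈-Γ₂⁻ = ∈-enumerate⁻ _≟ₛ_ (λ P → ∣ P ∣ ≟ℕ 2) Γ

    Γ₂-size : OfSize 2 Γ₂
    Γ₂-size = All.tabulate (proj₂ ∘ ∈-Γ₂⁻)

    F⇒gate : ∀ {X} → F X → X ∈ Γ
    F⇒gate {X} FX = VertexSet⇒gate (valid C) (solution X FX) (F⇒2≤∣X∣ FX)

    -- Each tree of 𝒯₄depth2-list splits into a pair gate and a pair that is
    -- either a gate or charged to a triple gate inside the tree.
    record Charged (R : List (Subset n)) : Set where
      field
        triples        : List (Subset n)
        pairs          : List (Subset n)
        length-pairs   : length pairs ≡ length triples
        triples-Unique : Unique triples
        triples-gates  : All (_∈ Γ) triples
        triples-size   : OfSize 3 triples
        triples-inside : All (λ X → Any (X ⊆_) R) triples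
        pairs-size     : OfSize 2 pairs
        splits         : All (SplitsIn (Γ₂ ++ pairs)) R

    open Charged

    charge : ∀ R → Unique R → All 𝒯₄depth2-members R → Charged R
    charge []      _           _         = record
      { triples = [] ; pairs = [] ; length-pairs = refl ; triples-Unique = [] ; triples-gates = []
      ; triples-size = [] ; triples-inside = [] ; pairs-size = [] ; splits = [] }
    charge (T ∷ R) (T∉R ∷ uR) (dT ∷ dR) =
      charge-∷ (quadSplit (valid C) (solution T (inj₂ (inj₂ dT))) (∣𝒯₄depth2∣ dT)) (charge R uR dR)
      where
      charge-∷ : QuadSplit (valid C) T → Charged R → Charged (T ∷ R)
      charge-∷ (two-pairs A∈Γ B∈Γ ∣A∣≡2 ∣B∣≡2 du) E = record
        { triples        = triples E
        ; pairs          = pairs E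
        ; length-pairs   = length-pairs E
        ; triples-Unique = triples-Unique E
        ; triples-gates  = triples-gates E
        ; triples-size   = triples-size E
        ; triples-inside = All.map there (triples-inside E)
        ; pairs-size     = pairs-size E
        ; splits         = lose (∈-++⁺ˡ (∈-Γ₂⁺ A∈Γ ∣A∣≡2)) (lose (∈-++⁺ˡ (∈-Γ₂⁺ B∈Γ ∣B∣≡2)) du) ∷ splits E
        }
      charge-∷ (via-triple {X} {B = B} X∈Γ ∣X∣≡3 X⊆T A∈Γ ∣A∣≡2 ∣B∣≡2 du) E = record
        { triples        = X ∷ triples E
        ; pairs          = B ∷ pairs E
        ; length-pairs   = cong suc (length-pairs E)
        ; triples-Unique = All.map fresh (triples-inside E) ∷ triples-Unique E
        ; triples-gates  = X∈Γ ∷ triples-gates E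
        ; triples-size   = ∣X∣≡3 ∷ triples-size E
        ; triples-inside = here X⊆T ∷ All.map there (triples-inside E)
        ; pairs-size     = ∣B∣≡2 ∷ pairs-size E
        ; splits         = lose (∈-++⁺ˡ (∈-Γ₂⁺ A∈Γ ∣A∣≡2)) (lose (∈-++⁺ʳ Γ₂ (here refl)) du)
                         ∷ All.map (SplitsIn-resp-⊆ (++⁺ʳ Γ₂ (xs⊆x∷xs _ B))) (splits E)
        }
        where
        fresh : ∀ {X′} → Any (X′ ⊆_) R → X ≢ X′
        fresh X′⊆R refl with T′ , T′∈R , X⊆T′ ← find X′⊆R =
          All.lookup T∉R T′∈R (𝒯₄depth2-shared-triple⇒≡ dT (All.lookup dR T′∈R) X⊆T X⊆T′ ∣X∣≡3)

    charged : Charged 𝒯₄depth2-list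
    charged = charge 𝒯₄depth2-list (enumerate-Unique _≟ₛ_ 𝒯₄depth2? 𝒯) (All.tabulate ∈-𝒯₄depth2-list⁻)

    counted : List (Subset n)
    counted = 𝒯₄depth2-list ++ 𝒯₃′-list ++ Γ₂ ++ triples charged

    -- Sizes separate the blocks, except for the triples of 𝒯₃′ and the charged triples.
    counted-Unique : Unique counted
    counted-Unique =
      Unique.++⁺ (enumerate-Unique _≟ₛ_ 𝒯₄depth2? 𝒯)
        (Unique.++⁺ (enumerate-Unique _≟ₛ_ 𝒯₃′? 𝒯₃′-candidates)
          (Unique.++⁺ (enumerate-Unique _≟ₛ_ _ Γ) (triples-Unique charged)
            (All¬⇒Disjoint Γ₂-size (OfSize⇒≢ (triples-size charged) λ ())))
          (All¬⇒Disjoint (All.tabulate ∈-𝒯₃′-list⁻)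
            (All-++⁺ (All.map (λ ∣P∣≡2 q → contradiction (trans (sym ∣P∣≡2) (∣𝒯₃′∣ q)) λ ()) Γ₂-size)
                     (All.map outside-𝒯₃′ (triples-inside charged)))))
        (All¬⇒Disjoint (All.tabulate (∣𝒯₄depth2∣ ∘ ∈-𝒯₄depth2-list⁻))
          (All-++⁺ (OfSize⇒≢ (All.tabulate (∣𝒯₃′∣ ∘ ∈-𝒯₃′-list⁻)) λ ())
            (All-++⁺ (OfSize⇒≢ Γ₂-size λ ()) (OfSize⇒≢ (triples-size charged) λ ()))))
      where
      outside-𝒯₃′ : ∀ {X} → Any (X ⊆_) 𝒯₄depth2-list → ¬ 𝒯₃′-members X
      outside-𝒯₃′ X⊆R q with T , T∈R , X⊆T ← find X⊆R = 𝒯₄depth2-∌-𝒯₃′ (∈-𝒯₄depth2-list⁻ T∈R) q X⊆T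

    counted-gates : All (_∈ Γ) counted
    counted-gates =
      All-++⁺ (All.tabulate (F⇒gate ∘ inj₂ ∘ inj₂ ∘ ∈-𝒯₄depth2-list⁻))
        (All-++⁺ (All.tabulate (F⇒gate ∘ inj₂ ∘ inj₁ ∘ ∈-𝒯₃′-list⁻))
          (All-++⁺ (All.tabulate (proj₁ ∘ ∈-Γ₂⁻)) (triples-gates charged)))

    certificate : List (Subset n)
    certificate = Γ₂ ++ pairs charged

    certificate-Certificate : Certificate certificate
    certificate-Certificate =
      All-++⁺ Γ₂-size (pairs-size charged) ,
      All.tabulate (λ X∈𝒯 ∣X∣≡2 → ∈-++⁺ˡ (∈-Γ₂⁺ (F⇒gate (inj₁ (X∈𝒯 , ∣X∣≡2))) ∣X∣≡2)) ,
      All.tabulate pair-inside ,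
      splits charged
      where
      pair-inside : ∀ {Q} → Q ∈ 𝒯₃′-list → Any (_⊆ Q) certificate
      pair-inside {Q} Q∈ with q ← ∈-𝒯₃′-list⁻ Q∈
        with A , A∈Γ , ∣A∣≡2 , A⊆Q ← triple⇒pair-gate (valid C) (solution Q (inj₂ (inj₁ q))) (∣𝒯₃′∣ q)
        = lose (∈-++⁺ˡ (∈-Γ₂⁺ A∈Γ ∣A∣≡2)) A⊆Q

    cost-certificate≤size : cost certificate ≤ size C
    cost-certificate≤size = begin
      cost certificate      ≤⟨ length-++-monoʳ 𝒯₄depth2-list (length-++-monoʳ 𝒯₃′-list
                                 (length-++-monoʳ Γ₂ (≤-reflexive (length-pairs charged)))) ⟩
      length counted        ≤⟨ Unique∧⊆⇒length≤ counted-Unique (All.lookup counted-gates) ⟩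
      length Γ              ≡⟨ length-gateSets (gates C) ⟩
      size C                ∎
      where open ≤-Reasoning

  allPairs-Certificate : Certificate (allPairs n)
  allPairs-Certificate =
    allPairs-ofSize , All.tabulate (λ _ → ∈-allPairs) , All.tabulate pair-inside , All.tabulate pair-split
    where
    pair-inside : ∀ {Q} → Q ∈ 𝒯₃′-list → Any (_⊆ Q) (allPairs n)
    pair-inside {Q} Q∈ with A , A⊆Q , ∣A∣≡2 ← ∃⊆-ofSize Q (a≡2+m⇒2≤a (∣𝒯₃′∣ (∈-𝒯₃′-list⁻ Q∈))) =
      lose (∈-allPairs ∣A∣≡2) A⊆Q

    pair-split : ∀ {T} → T ∈ 𝒯₄depth2-list → SplitsIn (allPairs n) T
    pair-split {T} T∈ with ∣T∣≡4 ← ∣𝒯₄depth2∣ (∈-𝒯₄depth2-list⁻ T∈)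
      with A , A⊆T , ∣A∣≡2 ← ∃⊆-ofSize T (a≡2+m⇒2≤a ∣T∣≡4)
      = lose (∈-allPairs ∣A∣≡2)
             (lose (∈-allPairs (∣DisjointUnion∣ʳ du (trans ∣T∣≡4 (cong (_+ 2) (sym ∣A∣≡2))))) du)
      where du = ⊆⇒DisjointUnion-─ A⊆T

  candidates : List (List (Subset n))
  candidates = filter certificate? (sublists (allPairs n))

  best : List (Subset n)
  best = argmin cost (allPairs n) candidates

  best-Certificate : Certificate best
  best-Certificate = argmin-all cost {xs = candidates} allPairs-Certificate
    (All.tabulate (proj₂ ∘ ∈-filter⁻ certificate? {xs = sublists (allPairs n)}))

  best-minimal : ∀ {L} → Certificate L → cost best ≤ cost L
  best-minimal {L} (∣L∣≡2 , covers) = begin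
    cost best  ≤⟨ All.lookup (f[argmin]≤f[xs] {f = cost} (allPairs n) candidates) L′∈candidates ⟩
    cost L′    ≤⟨ length-++-monoʳ 𝒯₄depth2-list (length-++-monoʳ 𝒯₃′-list ∣L′∣≤∣L∣) ⟩
    cost L     ∎
    where
    open ≤-Reasoning

    L′ : List (Subset n)
    L′ = filter (_∈? L) (allPairs n)

    L⊆L′ : L List.⊆ L′
    L⊆L′ P∈L = ∈-filter⁺ (_∈? L) (∈-allPairs (All.lookup ∣L∣≡2 P∈L)) P∈L

    ∣L′∣≡2 : OfSize 2 L′
    ∣L′∣≡2 = All.tabulate (All.lookup allPairs-ofSize ∘ proj₁ ∘ ∈-filter⁻ (_∈? L) {xs = allPairs n})

    L′∈candidates : L′ ∈ candidates
    L′∈candidates = ∈-filter⁺ certificate? (filter∈sublists (_∈? L) (allPairs n))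
                              (∣L′∣≡2 , Covers-resp-⊆ L⊆L′ covers)

    ∣L′∣≤∣L∣ : length L′ ≤ length L
    ∣L′∣≤∣L∣ = Unique∧⊆⇒length≤ (Unique.filter⁺ (_∈? L) allPairs-Unique)
                                (proj₂ ∘ ∈-filter⁻ (_∈? L) {xs = allPairs n})

  optimal : ∀ (C : Circuit n) → size C ≡ cost best → ∀ C′ → IsSolution F C′ → size C ≤ size C′
  optimal C size≡cost C′ solution′ = begin
    size C            ≡⟨ size≡cost ⟩
    cost best         ≤⟨ best-minimal certificate-Certificate ⟩
    cost certificate  ≤⟨ cost-certificate≤size ⟩
    size C′           ∎
    where
    open ≤-Reasoning
    open LowerBound C′ solution′

  optimum : ∃[ C ] (IsOptimum F C × Depth2 C)
  optimum = let C , size≡cost , solution , depth2 = canonical best-Certificate in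
    C , (solution , optimal C size≡cost) , depth2

lemma9 : (n : ℕ) (𝒯 : List (Subset n)) →
         All (λ T → ∣ T ∣ ≡ 2 ⊎ ∣ T ∣ ≡ 3 ⊎ ∣ T ∣ ≡ 4) 𝒯 →
         (𝒯int : Fam n) → IntersectRun 𝒯 (𝒯⊋3 𝒯) 𝒯int →
         (M : List (Subset n × Subset n)) → IsMaxMatching 𝒯 𝒯int M →
         ∃[ C ] (IsOptimum (𝒯depth≤2 𝒯 𝒯int M) C × Depth2 C)
lemma9 n 𝒯 _ 𝒯int run M maxM = Instance.optimum 𝒯 𝒯int run M maxM
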